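{- Let $q\ge 5$ be a prime, let $b=\frac{q-1}{2}$, and let $c\ge 1$ be an integer. For every integer $m$ with $0\le m<b^{c+1}$, let $B_m(X)=\sum_{k=0}^{c} m_k X^k$ be its base polynomial and let $\mathcal{D}(m)$ be its set of derived polynomials (both as defined in the context). Let $i,j\ge 0$ be integers with $i+j<b^{c+1}$. Then for every assignment $x\in\mathbb{F}_q$ of the variable $X$, if index $0$ of $V_2$ (represented by the zero polynomial) is aligned with the base polynomial $B_i$ representing index $i$ of $V_1$, i.e. the shift is $s=B_i(x)$, then index $j$ of $V_2$ is aligned with one of the polynomials representing index $i+j$ of $V_1$; that is, there exists $D\in\mathcal{D}(i+j)$ with $D(x)\equiv B_i(x)+B_j(x)\pmod q$.
   Context: Setting (length reduction for sparse convolution): $V_1,V_2$ are integer-indexed vectors given as lists of (index, value) pairs of their non-zero entries. Fix a prime $q$, put $b=(q-1)/2$ and a degree bound $c$. Base polynomial: an integer $m$ with $0\le m<b^{c+1}$ is written in base $b$ as $m=\sum_{k=0}^{c} m_k b^k$ with digits $0\le m_k\le b-1$, and its base polynomial is $B_m(X)=\sum_{k=0}^{c} m_k X^k$ (integer coefficients, also viewed over $\mathbb{F}_q$). Derived polynomials: for each subset $S\subseteq\{0,1,\dots,c-1\}$, the polynomial $P_{m,S}(X)=\sum_{k=0}^{c}\big(m_k+b\,[k\in S]-[k-1\in S]\big)X^k$, i.e. for each $k\in S$ one adds $b$ to the coefficient of $X^k$ and subtracts $1$ from the coefficient of $X^{k+1}$; the set $\mathcal{D}(m)=\{P_{m,S}: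 S\subseteq\{0,\dots,c-1\}\}$ has $2^c$ members and contains $B_m$ (the case $S=\emptyset$). A non-zero index $m$ of $V_1$ is represented by all polynomials in $\mathcal{D}(m)$; a non-zero index $j$ of $V_2$ is represented only by its base polynomial $B_j$ (index $0$ by the zero polynomial). An assignment $x\in\mathbb{F}_q$ maps each represented index to the positions obtained by evaluating its polynomials at $x$ in $\mathbb{F}_q$, giving reduced vectors of length $q$. Alignment with shift $s$: position $p$ of the reduced $V_2$ is aligned with position $p+s \pmod q$ of the reduced $V_1$. -}

module Defs where

open import Data.Nat as ℕ using (ℕ; zero; suc; _<?_)
open import Data.Nat.DivMod using (_/_; _%_)
open import Data.Nat.Primality using (Prime)
open import Data.Integer as ℤ using (ℤ; +_)
open import Data.Integer.Divisibility using () renaming (_∣_ to _∣ℤ_)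
open import Data.Fin using (Fin; fromℕ<)
open import Data.Bool using (Bool; true; false; if_then_else_)
open import Data.List using (List; []; _∷_; upTo; map; foldr)
open import Relation.Nullary using (yes; no)

half : ℕ → ℕ
half q = (q ℕ.∸ 1) / 2

-- k-th base-b digit of m: ⌊m / b^k⌋ mod b (computed as iterated division)  (b = 0 is a degenerate case, never used since q ≥ 5)
digit : ℕ → ℕ → ℕ → ℕ
digit zero    m k       = 0
digit (suc b) m zero    = m % suc b
digit (suc b) m (suc k) = digit (suc b) (m / suc b) k

-- a polynomial of degree ≤ c given by its coefficient function on {0,…,c}
-- evaluation Σ_{k=0}^{c} a k * x^k over ℤ
eval : ℕ → (ℕ → ℤ) → ℤ → ℤ
eval c a x = foldr ℤ._+_ (+ 0) (map (λ k → a k ℤ.* (x ℤ.^ k)) (upTo (suc c)))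

baseCoeff : ℕ → ℕ → ℕ → ℤ
baseCoeff b m k = + digit b m k

-- subsets S ⊆ {0,…,c-1} as characteristic functions Fin c → Bool;
-- membership of an arbitrary natural k (false when k ≥ c)
inS : (c : ℕ) → (Fin c → Bool) → ℕ → Bool
inS c S k with k <? c
... | yes k<c = S (fromℕ< k<c)
... | no  _   = false

ind : Bool → ℤ
ind true  = + 1
ind false = + 0

indPred : (c : ℕ) → (Fin c → Bool) → ℕ → ℤ
indPred c S zero    = + 0
indPred c S (suc k) = ind (inS c S k)

derivedCoeff : ℕ → (c : ℕ) → ℕ → (Fin c → Bool) → ℕ → ℤ
derivedCoeff b c m S k = (baseCoeff b m k ℤ.+ (+ b) ℤ.* ind (inS c S k)) ℤ.- indPred c S k

_≡_[mod_] : ℤ → ℤ → ℕ → Set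
a ≡ b' [mod q ] = (+ q) ∣ℤ (a ℤ.- b')

-- Adding the base-b expansions of i and j column by column, column k receives a carry
-- c_k ∈ {0,1} and sends c_{k+1} on, so i_k + j_k + c_k = (i+j)_k + b c_{k+1}.  Taking S to be
-- the set of columns that emit a carry, the coefficients of P_{i+j,S} are exactly i_k + j_k
-- (the carry out of the top column vanishes as i + j < b^{c+1}).  Hence P_{i+j,S} = B_i + B_j
-- already in ℤ[X]: the congruence holds for every x, q and b ≥ 1.
module Submission where

open import Defs
open import Data.Nat using (ℕ; _≤_; _<_; _+_; _^_)
open import Data.Nat.Primality using (Prime)
open import Data.Integer using (+_) renaming (_+_ to _+ℤ_)
open import Data.Fin using (Fin; toℕ)
open import Data.Bool using (Bool)
open import Data.Product using (∃)

open import Data.Nat as ℕ using (zero; suc; z≤n; s≤s; s≤s⁻¹; _≤ᵇ_; _<?_)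
open import Data.Nat.DivMod
open import Data.Nat.Divisibility using (n∣m*n; _∣0)
open import Data.Nat.Properties
open import Data.Nat.Tactic.RingSolver using (solve-∀)
open import Data.Integer as ℤ using (ℤ; 0ℤ; _-_)
import Data.Integer.Properties as ZP
open import Algebra.Properties.CommutativeSemigroup ZP.+-commutativeSemigroup using (interchange)
open import Data.Fin.Properties using (toℕ-fromℕ<)
open import Data.List using (List; []; _∷_; upTo; map; foldr)
open import Data.List.Membership.Propositional using (_∈_)
open import Data.List.Membership.Propositional.Properties using (∈-upTo⁻)
open import Data.List.Relation.Unary.Any using (here; there)
open import Data.Product using (_,_; map₂)
open import Relation.Nullary using (yes; no; contradiction)
open import Relation.Binary.PropositionalEquality
open import Function using (_∘_)

sumℤ : List ℤ → ℤ
sumℤ = foldr _+ℤ_ 0ℤ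

sumℤ-map-+ : ∀ {A : Set} (f g h : A → ℤ) (xs : List A) → (∀ {x} → x ∈ xs → f x ≡ g x +ℤ h x) →
             sumℤ (map f xs) ≡ sumℤ (map g xs) +ℤ sumℤ (map h xs)
sumℤ-map-+ f g h []       _       = refl
sumℤ-map-+ f g h (x ∷ xs) f≡g+h = begin
  f x +ℤ sumℤ (map f xs)
    ≡⟨ cong₂ _+ℤ_ (f≡g+h (here refl)) (sumℤ-map-+ f g h xs (f≡g+h ∘ there)) ⟩
  (g x +ℤ h x) +ℤ (sumℤ (map g xs) +ℤ sumℤ (map h xs))
    ≡⟨ interchange (g x) (h x) _ _ ⟩
  (g x +ℤ sumℤ (map g xs)) +ℤ (h x +ℤ sumℤ (map h xs)) ∎
  where open ≡-Reasoning

eval-+ : ∀ c (a a₁ a₂ : ℕ → ℤ) x → (∀ k → k ≤ c → a k ≡ a₁ k +ℤ a₂ k) →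
         eval c a x ≡ eval c a₁ x +ℤ eval c a₂ x
eval-+ c a a₁ a₂ x a≡a₁+a₂ =
  sumℤ-map-+ (term a) (term a₁) (term a₂) (upTo (suc c)) λ {k} k∈ →
  trans (cong (ℤ._* x ℤ.^ k) (a≡a₁+a₂ k (s≤s⁻¹ (∈-upTo⁻ k∈))))
        (ZP.*-distribʳ-+ (x ℤ.^ k) (a₁ k) (a₂ k))
  where
  term : (ℕ → ℤ) → ℕ → ℤ
  term a k = a k ℤ.* x ℤ.^ k

i+j-j≡i : ∀ x y → (x +ℤ y) - y ≡ x
i+j-j≡i x y = begin
  (x +ℤ y) - y     ≡⟨ ZP.+-assoc x y (ℤ.- y) ⟩
  x +ℤ (y - y)     ≡⟨ cong (x +ℤ_) (ZP.+-inverseʳ y) ⟩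
  x +ℤ 0ℤ          ≡⟨ ZP.+-identityʳ x ⟩
  x                ∎
  where open ≡-Reasoning

column-carry : ∀ {x y s b c c′} → x + y + c ≡ s + b ℕ.* c′ →
               (+ s +ℤ + b ℤ.* + c′) - + c ≡ + x +ℤ + y
column-carry {x} {y} {s} {b} {c} {c′} eq = begin
  (+ s +ℤ + b ℤ.* + c′) - + c   ≡⟨ cong (λ t → (+ s +ℤ t) - + c) (sym (ZP.pos-* b c′)) ⟩
  (+ s +ℤ + (b ℕ.* c′)) - + c   ≡⟨ cong (_- + c) (sym (ZP.pos-+ s (b ℕ.* c′))) ⟩
  + (s + b ℕ.* c′) - + c        ≡⟨ cong (λ t → + t - + c) (sym eq) ⟩
  + (x + y + c) - + c           ≡⟨ cong (_- + c) (ZP.pos-+ (x + y) c) ⟩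
  (+ (x + y) +ℤ + c) - + c      ≡⟨ i+j-j≡i (+ (x + y)) (+ c) ⟩
  + (x + y)                     ≡⟨ ZP.pos-+ x y ⟩
  + x +ℤ + y                    ∎
  where open ≡-Reasoning

ind-1≤ᵇ : ∀ {n} → n ≤ 1 → ind (1 ≤ᵇ n) ≡ + n
ind-1≤ᵇ z≤n       = refl
ind-1≤ᵇ (s≤s z≤n) = refl

≡⇒≡[mod] : ∀ {a a′} q → a ≡ a′ → a ≡ a′ [mod q ]
≡⇒≡[mod] {a} q refl rewrite ZP.+-inverseʳ a = q ∣0

module ColumnAddition (b-1 : ℕ) where

  b : ℕ
  b = suc b-1

  columnSum : ℕ → ℕ → ℕ → ℕ
  columnSum i j e = i % b + (e + j % b)

  -- carry into column k when adding i and j with incoming carry e into column 0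
  carry : ℕ → ℕ → ℕ → ℕ → ℕ
  carry i j e zero    = e
  carry i j e (suc k) = carry (i / b) (j / b) (columnSum i j e / b) k

  sum≡columnSum+quotients : ∀ i j e → i + j + e ≡ columnSum i j e + (i / b + j / b) ℕ.* b
  sum≡columnSum+quotients i j e = begin
    i + j + e
      ≡⟨ cong₂ (λ i′ j′ → i′ + j′ + e) (m≡m%n+[m/n]*n i b) (m≡m%n+[m/n]*n j b) ⟩
    (i % b + i / b ℕ.* b) + (j % b + j / b ℕ.* b) + e
      ≡⟨ regroup (i % b) (i / b) (j % b) (j / b) e b ⟩
    i % b + (e + j % b) + (i / b + j / b) ℕ.* b ∎
    where
    open ≡-Reasoning
    regroup : ∀ r q r′ q′ e n → (r + q ℕ.* n) + (r′ + q′ ℕ.* n) + e ≡ r + (e + r′) + (q + q′) ℕ.* n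
    regroup = solve-∀

  /-columnSum : ∀ i j e → (i + j + e) / b ≡ i / b + j / b + columnSum i j e / b
  /-columnSum i j e = begin
    (i + j + e) / b           ≡⟨ cong (_/ b) (sum≡columnSum+quotients i j e) ⟩
    (s + q ℕ.* b) / b         ≡⟨ +-distrib-/-∣ʳ s (n∣m*n q) ⟩
    s / b + q ℕ.* b / b       ≡⟨ cong (λ t → s / b + t) (m*n/n≡m q b) ⟩
    s / b + q                 ≡⟨ +-comm (s / b) q ⟩
    q + s / b                 ∎
    where
    open ≡-Reasoning
    s = columnSum i j e
    q = i / b + j / b

  %-columnSum : ∀ i j e → (i + j + e) % b ≡ columnSum i j e % b
  %-columnSum i j e = trans (cong (_% b) (sum≡columnSum+quotients i j e))
                            ([m+kn]%n≡m%n (columnSum i j e) (i / b + j / b) b)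

  digit-+ : ∀ k i j e → digit b i k + digit b j k + carry i j e k
                        ≡ digit b (i + j + e) k + b ℕ.* carry i j e (suc k)
  digit-+ zero i j e = begin
    i % b + j % b + e                      ≡⟨ +-assoc (i % b) (j % b) e ⟩
    i % b + (j % b + e)                    ≡⟨ cong (λ t → i % b + t) (+-comm (j % b) e) ⟩
    s                                      ≡⟨ m≡m%n+[m/n]*n s b ⟩
    s % b + s / b ℕ.* b                    ≡⟨ cong₂ _+_ (sym (%-columnSum i j e)) (*-comm (s / b) b) ⟩
    (i + j + e) % b + b ℕ.* (s / b)        ∎
    where
    open ≡-Reasoning
    s = columnSum i j e
  digit-+ (suc k) i j e rewrite /-columnSum i j e =
    digit-+ k (i / b) (j / b) (columnSum i j e / b)

  columnSum<2b : ∀ i j e → e ≤ 1 → columnSum i j e < 2 ℕ.* b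
  columnSum<2b i j e e≤1 = subst (columnSum i j e <_) (cong (λ t → b + t) (sym (+-identityʳ b)))
    (+-mono-<-≤ (m%n<n i b) (≤-trans (+-monoˡ-≤ (j % b) e≤1) (m%n<n j b)))

  carry≤1 : ∀ k i j e → e ≤ 1 → carry i j e k ≤ 1
  carry≤1 zero    i j e e≤1 = e≤1
  carry≤1 (suc k) i j e e≤1 =
    carry≤1 k (i / b) (j / b) (columnSum i j e / b) (s≤s⁻¹ (m<n*o⇒m/o<n (columnSum<2b i j e e≤1)))

  1≤carry⇒b^k≤sum : ∀ k i j e → 1 ≤ carry i j e k → b ^ k ≤ i + j + e
  1≤carry⇒b^k≤sum zero    i j e 1≤e = ≤-trans 1≤e (m≤n+m e (i + j))
  1≤carry⇒b^k≤sum (suc k) i j e 1≤carry = begin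
    b ℕ.* b ^ k             ≤⟨ *-monoʳ-≤ b b^k≤sum/b ⟩
    b ℕ.* ((i + j + e) / b) ≡⟨ *-comm b _ ⟩
    (i + j + e) / b ℕ.* b   ≤⟨ m/n*n≤m (i + j + e) b ⟩
    i + j + e               ∎
    where
    open ≤-Reasoning
    b^k≤sum/b : b ^ k ≤ (i + j + e) / b
    b^k≤sum/b = subst (b ^ k ≤_) (sym (/-columnSum i j e))
                  (1≤carry⇒b^k≤sum k (i / b) (j / b) (columnSum i j e / b) 1≤carry)

  carry-top≡0 : ∀ c i j → i + j < b ^ suc c → carry i j 0 (suc c) ≡ 0
  carry-top≡0 c i j i+j<b^[1+c] with carry i j 0 (suc c) in eq
  ... | zero  = refl
  ... | suc _ = contradiction (1≤carry⇒b^k≤sum (suc c) i j 0 (subst (1 ≤_) (sym eq) (s≤s z≤n)))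
                              (<⇒≱ (subst (_< b ^ suc c) (sym (+-identityʳ (i + j))) i+j<b^[1+c]))

  carrySet : (c i j : ℕ) → Fin c → Bool
  carrySet c i j k = 1 ≤ᵇ carry i j 0 (suc (toℕ k))

  ind-inS-carrySet : ∀ c i j → i + j < b ^ suc c → ∀ k → k ≤ c →
                     ind (inS c (carrySet c i j) k) ≡ + carry i j 0 (suc k)
  ind-inS-carrySet c i j i+j<b^[1+c] k k≤c with k <? c
  ... | yes k<c rewrite toℕ-fromℕ< k<c = ind-1≤ᵇ (carry≤1 (suc k) i j 0 z≤n)
  ... | no  k≮c rewrite ≤-antisym k≤c (≮⇒≥ k≮c) | carry-top≡0 c i j i+j<b^[1+c] = refl

  indPred-carrySet : ∀ c i j → i + j < b ^ suc c → ∀ k → k ≤ c →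
                     indPred c (carrySet c i j) k ≡ + carry i j 0 k
  indPred-carrySet c i j i+j<b^[1+c] zero    _   = refl
  indPred-carrySet c i j i+j<b^[1+c] (suc k) k<c = ind-inS-carrySet c i j i+j<b^[1+c] k (<⇒≤ k<c)

  derivedCoeff-carrySet : ∀ c i j → i + j < b ^ suc c → ∀ k → k ≤ c →
                          derivedCoeff b c (i + j) (carrySet c i j) k ≡ baseCoeff b i k +ℤ baseCoeff b j k
  derivedCoeff-carrySet c i j i+j<b^[1+c] k k≤c = begin
    (+ digit b (i + j) k +ℤ + b ℤ.* ind (inS c S k)) - indPred c S k
      ≡⟨ cong₂ (λ u v → (+ digit b (i + j) k +ℤ + b ℤ.* u) - v)
               (ind-inS-carrySet c i j i+j<b^[1+c] k k≤c) (indPred-carrySet c i j i+j<b^[1+c] k k≤c) ⟩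
    (+ digit b (i + j) k +ℤ + b ℤ.* + carry i j 0 (suc k)) - + carry i j 0 k
      ≡⟨ column-carry {digit b i k} {digit b j k} {b = b} {c′ = carry i j 0 (suc k)} column-k ⟩
    + digit b i k +ℤ + digit b j k ∎
    where
    open ≡-Reasoning
    S = carrySet c i j
    column-k : digit b i k + digit b j k + carry i j 0 k ≡ digit b (i + j) k + b ℕ.* carry i j 0 (suc k)
    column-k = subst (λ n → digit b i k + digit b j k + carry i j 0 k ≡ digit b n k + b ℕ.* carry i j 0 (suc k))
                     (+-identityʳ (i + j)) (digit-+ k i j 0)

derived≡base+base : ∀ b → 1 ≤ b → ∀ c i j → i + j < b ^ (c + 1) → ∀ x →
                    ∃ λ (S : Fin c → Bool) →
                      eval c (derivedCoeff b c (i + j) S) x ≡ eval c (baseCoeff b i) x +ℤ eval c (baseCoeff b j) x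
derived≡base+base (suc b-1) _ c i j i+j<b^[c+1] x =
  carrySet c i j ,
  eval-+ c (derivedCoeff b c (i + j) (carrySet c i j)) (baseCoeff b i) (baseCoeff b j) x
         (derivedCoeff-carrySet c i j i+j<b^[1+c])
  where
  open ColumnAddition b-1
  i+j<b^[1+c] : i + j < b ^ suc c
  i+j<b^[1+c] = subst (λ e → i + j < b ^ e) (+-comm c 1) i+j<b^[c+1]

lemma1 : (q : ℕ) → Prime q → 5 ≤ q → (c : ℕ) → 1 ≤ c →
    (i j : ℕ) → i + j < half q ^ (c + 1) → (x : Fin q) →
    ∃ λ (S : Fin c → Bool) →
      eval c (derivedCoeff (half q) c (i + j) S) (+ toℕ x)
        ≡ eval c (baseCoeff (half q) i) (+ toℕ x) +ℤ eval c (baseCoeff (half q) j) (+ toℕ x) [mod q ]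
lemma1 q _ 5≤q c _ i j i+j<b^[c+1] x =
  map₂ (≡⇒≡[mod] q) (derived≡base+base (half q) 1≤half c i j i+j<b^[c+1] (+ toℕ x))
  where
  1≤half : 1 ≤ half q
  1≤half = ≤-trans (s≤s z≤n) (/-monoˡ-≤ 2 (∸-monoˡ-≤ 1 5≤q))
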